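{- Let $\alpha,\beta,q\in\mathbb{Z}$ and let $(Z_n : NC^{\mathrm{(mton)}}_2(2n)\to\mathbb{R})_{n\ge1}$ be pair-recursive of the second kind with input $(\alpha,\beta;q)$, each $NC^{\mathrm{(mton)}}_2(2n)$ carrying the uniform distribution. Then for every $n\ge2$, $$E[Z_n] = \frac{(2n-1)+(\alpha-\beta)}{2n-1}\,E[Z_{n-1}] + \frac{q\alpha + ((2n-1)-q)\beta}{2n-1}.$$
   Context: $NC_2(2n)$: non-crossing pair-partitions of $\{1,\ldots,2n\}$. For blocks $V,W$, "$V$ nested inside $W$" means $\min V>\min W$ and $\max V<\max W$. A monotonic ordering of $\pi\in NC_2(2n)$ is a bijection $u:\pi\to\{1,\ldots,n\}$ with $u(V)>u(W)$ whenever $V$ is nested inside $W$; $NC^{\mathrm{(mton)}}_2(2n)$ is the set of such pairs $(\pi,u)$. $J(\pi,u):=u^{ -1}(n)$, which is of the form $\{m,m+1\}$. For $n\ge2$ the pair-parent $\mathfrak{pp}(\pi,u)=(\rho,v)\in NC^{\mathrm{(mton)}}_2(2n-2)$: with $J(\pi,u)=\{m,m+1\}$ and $\phi$ the increasing bijection from $\{1,\ldots,2n-2\}$ onto $\{1,\ldots,2n\}\setminus\{m,m+1\}$, $\rho=\{\{p,q'\} : \{\phi(p),\phi(q')\}\in\pi\}$ and $v(\{p,q'\}) = u(\{\phi(p),\phi(q')\})$. $C^{(\mathrm{pair})}(\rho,v) := \{(\pi,u) : \mathfrak{pp}(\pi,u)=(\rho,v)\}$. $(Z_n)$ is pair-recursive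 of the second kind with input $(\alpha,\beta;q)$ if for every $n\ge2$ and $(\rho,v)\in NC^{\mathrm{(mton)}}_2(2n-2)$ there is $C^{(\mathrm{pair})}_o(\rho,v)\subseteq C^{(\mathrm{pair})}(\rho,v)$ with $Z_n(\pi,u)=Z_{n-1}(\rho,v)+\alpha$ on $C^{(\mathrm{pair})}_o(\rho,v)$, $Z_n(\pi,u)=Z_{n-1}(\rho,v)+\beta$ on its complement in $C^{(\mathrm{pair})}(\rho,v)$, and $|C^{(\mathrm{pair})}_o(\rho,v)|=Z_{n-1}(\rho,v)+q$.
   Formalization: Every random variable $Z_n$ takes values in ℚ instead of ℝ. -}

module Defs where

open import Data.Bool using (Bool; true; false; T; _∧_; _∨_; not; if_then_else_)
open import Data.Nat using (ℕ; zero; suc; _+_; _*_; _<ᵇ_; _≡ᵇ_)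
open import Data.Fin using (Fin; toℕ; fromℕ; inject₁)
open import Data.Vec using (Vec; lookup)
open import Data.Bool.ListAction using (all)
open import Data.List.Base using (List; allFin; filterᵇ; length; map; foldr)
open import Data.Product using (Σ; _×_; _,_; proj₁; proj₂)
open import Data.Integer using (ℤ; +_)
open import Data.Rational using (ℚ; _/_; 0ℚ) renaming (_+_ to _+ℚ_; _*_ to _*ℚ_)
open import Data.List.Membership.Propositional using (_∈_)
open import Data.List.Relation.Unary.Unique.Propositional using (Unique)
open import Relation.Binary.PropositionalEquality using (_≡_)
open import Relation.Nullary using (¬_)

-- A block is stored as (min , max) of a pair {min,max} ⊆ {0,…,2n-1}.
Block : ℕ → Set
Block n = Fin (2 * n) × Fin (2 * n)

-- A monotonically ordered pair partition (π,u) of 2n points is encoded as the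
-- vector of its blocks listed by label: entry k (0-based) is u⁻¹(k+1).
lo hi : {k : ℕ} → Fin k × Fin k → ℕ
lo b = toℕ (proj₁ b)
hi b = toℕ (proj₂ b)

nestedᵇ : {k : ℕ} → Fin k × Fin k → Fin k × Fin k → Bool
nestedᵇ b c = (lo c <ᵇ lo b) ∧ (hi b <ᵇ hi c)

crossᵇ : {k : ℕ} → Fin k × Fin k → Fin k × Fin k → Bool
crossᵇ b c = (lo b <ᵇ lo c) ∧ ((lo c <ᵇ hi b) ∧ (hi b <ᵇ hi c))

validᵇ : (n : ℕ) → Vec (Block n) n → Bool
validᵇ n bs =
  all (λ k → lo (lookup bs k) <ᵇ hi (lookup bs k)) (allFin n)
  ∧ (all (λ i → length (filterᵇ (λ k → (lo (lookup bs k) ≡ᵇ toℕ i) ∨ (hi (lookup bs k) ≡ᵇ toℕ i)) (allFin n)) ≡ᵇ 1)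
         (allFin (2 * n))
  ∧ (all (λ j → all (λ k → not (crossᵇ (lookup bs j) (lookup bs k))) (allFin n)) (allFin n)
  -- monotonic: if block with label k is nested inside block with label j then k > j
  ∧ all (λ j → all (λ k → not (nestedᵇ (lookup bs k) (lookup bs j)) ∨ (toℕ j <ᵇ toℕ k)) (allFin n)) (allFin n)))

Mon : ℕ → Set
Mon n = Σ (Vec (Block n) n) (λ bs → T (validᵇ n bs))

blocks : {n : ℕ} → Mon n → Vec (Block n) n
blocks = proj₁

-- increasing bijection {0,…,2m-1} → {0,…,2m+1} ∖ {a,b}   (for a < b)
φ : ℕ → ℕ → ℕ → ℕ
φ a b p = if p <ᵇ a then p else (if suc p <ᵇ b then suc p else suc (suc p))

-- J(π,u) is the block with top label (index m); ρ's block with label k is the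
-- preimage under φ of π's block with the same label.
IsPairParent : (m : ℕ) → Mon (suc m) → Mon m → Set
IsPairParent m x ρ =
  (k : Fin m) →
    (lo (lookup (blocks x) (inject₁ k)) ≡ φ a b (lo (lookup (blocks ρ) k)))
    × (hi (lookup (blocks x) (inject₁ k)) ≡ φ a b (hi (lookup (blocks ρ) k)))
  where
  a = lo (lookup (blocks x) (fromℕ m))
  b = hi (lookup (blocks x) (fromℕ m))

ℤ→ℚ : ℤ → ℚ
ℤ→ℚ z = z / 1

ℕ→ℚ : ℕ → ℚ
ℕ→ℚ k = (+ k) / 1

-- 1/k for k ≥ 1 (and 0 for k = 0, never used with k = 0 below)
inv : ℕ → ℚ
inv zero = 0ℚ
inv (suc k) = (+ 1) / suc k

-- Pair-recursive of the second kind with input (α,β;q).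
-- A subset C_o of C^(pair)(ρ,v) is given as a duplicate-free list of its elements.
PairRecursive2 : ℤ → ℤ → ℤ → ((n : ℕ) → Mon n → ℚ) → Set
PairRecursive2 α β q Z =
  (m : ℕ) → 1 Data.Nat.≤ m → (ρ : Mon m) →
    Σ (List (Mon (suc m))) λ Co →
        Unique Co
      × ((x : Mon (suc m)) → x ∈ Co → IsPairParent m x ρ)
      × ((x : Mon (suc m)) → IsPairParent m x ρ → x ∈ Co → Z (suc m) x ≡ Z m ρ +ℚ ℤ→ℚ α)
      × ((x : Mon (suc m)) → IsPairParent m x ρ → ¬ (x ∈ Co) → Z (suc m) x ≡ Z m ρ +ℚ ℤ→ℚ β)
      × (ℕ→ℚ (length Co) ≡ Z m ρ +ℚ ℤ→ℚ q)

Enumeration : ℕ → Set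
Enumeration n = Σ (List (Mon n)) λ L → Unique L × ((x : Mon n) → x ∈ L)

E : {n : ℕ} → ((n : ℕ) → Mon n → ℚ) → Enumeration n → ℚ
E {n} Z (L , _) = foldr _+ℚ_ 0ℚ (map (Z n) L) *ℚ inv (length L)

-- The top-labelled block J(x) of a monotone non-crossing pairing x has no block nested inside it
-- (that block would need a larger label) and none crossing it, so J(x) = {a, a+1} for some a.
-- Deleting it and re-inserting an adjacent pair into any of the 2m+1 gaps are inverse operations,
-- so x ↦ (pp x, min J(x)) is a bijection NC^(mton)_2(2m+2) ≅ NC^(mton)_2(2m) × {0,…,2m}.
-- Of the 2m+1 children of ρ, exactly Z ρ + q take the value Z ρ + α and the others Z ρ + β, so
--   Σ Z (children of ρ) = (Z ρ + q)(Z ρ + α) + (2m+1 − Z ρ − q)(Z ρ + β)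
--                       = (2m+1 + α − β) Z ρ + qα + (2m+1 − q) β,
-- and summing over ρ and dividing by |NC^(mton)_2(2m+2)| = (2m+1) |NC^(mton)_2(2m)| gives the claim.

module Submission where

open import Defs
open import Data.Nat using (ℕ; suc; _≤_)
open import Data.Integer using (ℤ; +_; _-_)
open import Data.Rational using (ℚ; _+_; _*_)
open import Relation.Binary.PropositionalEquality using (_≡_)

open import Data.Bool using (Bool; true; false; T; _∨_; if_then_else_)
open import Data.Bool.ListAction using (all)
open import Data.Bool.Properties using (T-irrelevant)
open import Data.Empty using (⊥; ⊥-elim)
open import Data.Fin using (Fin; zero; suc; toℕ; fromℕ; fromℕ<; inject₁)
open import Data.Fin.Properties using (toℕ-inject₁; toℕ-fromℕ; toℕ<n; toℕ-fromℕ<; toℕ-injective; fromℕ≢inject₁)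
import Data.Fin.Properties as Fin
open import Data.Fin.Relation.Unary.Top using (view; ‵fromℕ; ‵inject₁)
import Data.Integer as ℤ
import Data.Integer.Properties as ℤ
open import Data.List as List using (List; []; _∷_; _++_; length; filter; filterᵇ; allFin; cartesianProductWith)
open import Data.List.Properties using (length-++; length-map; length-tabulate)
open import Data.List.Membership.Propositional using (_∈_; _∉_)
open import Data.List.Membership.Propositional.Properties using (∈-++⁺ˡ; ∈-++⁺ʳ; ∈-++⁻; ∈-filter⁺; ∈-filter⁻; ∈-map⁺; ∈-map⁻; ∈-allFin; ∈-cartesianProductWith⁺)
open import Data.List.Membership.Propositional.Properties.WithK using (unique∧set⇒bag)
import Data.List.Membership.DecPropositional as DecMembership
open import Data.List.Relation.Binary.BagAndSetEquality using (∼bag⇒↭)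
open import Data.List.Relation.Binary.Permutation.Propositional using (_↭_; ↭⇒↭ₛ)
import Data.List.Relation.Binary.Permutation.Propositional.Properties as ↭
open import Data.List.Relation.Binary.Permutation.Setoid.Properties using (foldr-commMonoid)
open import Data.List.Relation.Unary.Any using (here; there)
open import Data.List.Relation.Unary.Unique.Propositional using (Unique)
import Data.List.Relation.Unary.Unique.Propositional.Properties as Unique
open import Data.Nat using (zero; _<_; _<ᵇ_; _≡ᵇ_; s≤s; s<s; s≤s⁻¹; NonZero)
import Data.Nat as ℕ
open import Data.Nat.Properties using (_≟_; <ᵇ-reflects-<; ≡ᵇ⇒≡; ≡⇒≡ᵇ; ≮⇒≥; <-cmp; <-irrefl; <-trans; <-≤-trans; n<1+n; m<n⇒m<1+n; m≤n⇒m≤1+n; suc-injective; <⇒≢; >⇒≢; ≤∧≢⇒<; m*n≢0)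
import Data.Nat.Properties as ℕ
open import Data.Product using (Σ; _×_; _,_; proj₁; proj₂; uncurry)
import Data.Product.Properties as ×
open import Data.Rational using (0ℚ; 1ℚ; toℚᵘ)
import Data.Rational as ℚ
open import Data.Rational.Properties using (+-0-isCommutativeMonoid; +-assoc; +-identityˡ; *-assoc; *-comm; *-identityˡ; *-identityʳ; *-zeroˡ; toℚᵘ-injective; toℚᵘ-fromℚᵘ; toℚᵘ-homo-+; toℚᵘ-homo-*; toℚᵘ-homo‿-)
import Data.Rational.Unnormalised as ℚᵘ
import Data.Rational.Unnormalised.Properties as ℚᵘ
open import Data.Rational.Solver using (module +-*-Solver)
open import Data.Sum using (_⊎_; inj₁; inj₂; [_,_]; [_,_]′)
open import Data.Unit using (tt)
open import Data.Vec as Vec using (Vec; []; _∷_; _∷ʳ_; lookup)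
import Data.Vec.Properties as Vec
open import Function using (_∘_; id; _⇔_; mk⇔)
open import Relation.Binary.Definitions using (DecidableEquality; tri<; tri≈; tri>)
open import Relation.Binary.PropositionalEquality using (_≢_; refl; sym; trans; cong; cong₂; subst; subst₂; setoid; module ≡-Reasoning)
open import Relation.Nullary using (¬_; contradiction; yes; no)
open import Relation.Nullary.Decidable using (map′)
open import Relation.Nullary.Reflects using (Reflects; ofʸ; ofⁿ; fromEquivalence; det; _⊎-reflects_; _×-reflects_; ¬-reflects; _→-reflects_)

reflects⁺ : ∀ {A : Set} {b} → Reflects A b → A → T b
reflects⁺ (ofʸ _)  _ = tt
reflects⁺ (ofⁿ ¬a) a = ¬a a

reflects⁻ : ∀ {A : Set} {b} → Reflects A b → T b → A
reflects⁻ (ofʸ a) _ = a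

map-reflects : ∀ {A B : Set} {b} → (A → B) → (B → A) → Reflects A b → Reflects B b
map-reflects f g (ofʸ a)  = ofʸ (f a)
map-reflects f g (ofⁿ ¬a) = ofⁿ (¬a ∘ g)

all-tabulate-reflects : ∀ {A : Set} {n} {P : A → Set} {p : A → Bool} (f : Fin n → A) →
                        (∀ x → Reflects (P x) (p x)) → Reflects (∀ k → P (f k)) (all p (List.tabulate f))
all-tabulate-reflects {n = zero}  f r = ofʸ λ ()
all-tabulate-reflects {n = suc n} f r =
  map-reflects (λ (P₀ , P₊) → λ { zero → P₀ ; (suc k) → P₊ k }) (λ P → P zero , P ∘ suc)
               (r (f zero) ×-reflects all-tabulate-reflects (f ∘ suc) r)

≡ᵇ-reflects-≡ : ∀ m n → Reflects (m ≡ n) (m ≡ᵇ n)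
≡ᵇ-reflects-≡ m n = fromEquivalence (≡ᵇ⇒≡ m n) (≡⇒≡ᵇ m n)

no-ℕ-between : ∀ {a x} → a < x → x < suc a → ⊥
no-ℕ-between a<x (s≤s x≤a) = <-irrefl refl (<-≤-trans a<x x≤a)

toℕ-inject₁<toℕ-fromℕ : ∀ {m} (j : Fin m) → toℕ (inject₁ j) < toℕ (fromℕ m)
toℕ-inject₁<toℕ-fromℕ {m} j rewrite toℕ-inject₁ j | toℕ-fromℕ m = toℕ<n j

lookup-ext : ∀ {A : Set} {n} {xs ys : Vec A n} → (∀ k → lookup xs k ≡ lookup ys k) → xs ≡ ys
lookup-ext {xs = xs} {ys} eq = trans (sym (Vec.tabulate∘lookup xs)) (trans (Vec.tabulate-cong eq) (Vec.tabulate∘lookup ys))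

lookup-∷ʳ-inject₁ : ∀ {A : Set} {n} (xs : Vec A n) y k → lookup (xs ∷ʳ y) (inject₁ k) ≡ lookup xs k
lookup-∷ʳ-inject₁ (x ∷ xs) y zero    = refl
lookup-∷ʳ-inject₁ (x ∷ xs) y (suc k) = lookup-∷ʳ-inject₁ xs y k

lookup-∷ʳ-fromℕ : ∀ {A : Set} {n} (xs : Vec A n) y → lookup (xs ∷ʳ y) (fromℕ n) ≡ y
lookup-∷ʳ-fromℕ []       y = refl
lookup-∷ʳ-fromℕ (x ∷ xs) y = lookup-∷ʳ-fromℕ xs y

count : ∀ {n} → (Fin n → Bool) → ℕ
count {zero}  g = 0
count {suc n} g = if g zero then suc (count (g ∘ suc)) else count (g ∘ suc)

count-cong : ∀ {n} {g h : Fin n → Bool} → (∀ k → g k ≡ h k) → count g ≡ count h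
count-cong {zero}  g≗h = refl
count-cong {suc n} {g} {h} g≗h rewrite g≗h zero with h zero
... | true  = cong suc (count-cong (g≗h ∘ suc))
... | false = count-cong (g≗h ∘ suc)

count-last : ∀ {m} (g : Fin (suc m) → Bool) →
             count g ≡ count (g ∘ inject₁) ℕ.+ (if g (fromℕ m) then 1 else 0)
count-last {zero} g with g zero
... | true  = refl
... | false = refl
count-last {suc m} g with g zero
... | true  = cong suc (count-last (g ∘ suc))
... | false = count-last (g ∘ suc)

count-none : ∀ {n} {g : Fin n → Bool} → (∀ k → g k ≡ false) → count g ≡ 0
count-none {zero}  _   = refl
count-none {suc n} {g} g≗f rewrite g≗f zero = count-none (g≗f ∘ suc)

count≡0⇒¬T : ∀ {n} {g : Fin n → Bool} → count g ≡ 0 → ∀ k → ¬ T (g k)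
count≡0⇒¬T {suc n} {g} c k gk with g zero in g0
count≡0⇒¬T {suc n} {g} () k gk | true
count≡0⇒¬T {suc n} {g} c zero    gk | false = subst T g0 gk
count≡0⇒¬T {suc n} {g} c (suc k) gk | false = count≡0⇒¬T c k gk

count≡1⇒∃ : ∀ {n} {g : Fin n → Bool} → count g ≡ 1 → Σ (Fin n) λ k → T (g k)
count≡1⇒∃ {suc n} {g} c with g zero in g0
... | true  = zero , subst T (sym g0) tt
... | false = let k , gk = count≡1⇒∃ c in suc k , gk

count≡1⇒unique : ∀ {n} {g : Fin n → Bool} → count g ≡ 1 → ∀ {j k} → T (g j) → T (g k) → j ≡ k
count≡1⇒unique {suc n} {g} c {j} {k} gj gk with g zero in g0
... | true  = trans (only-zero j gj) (sym (only-zero k gk))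
  where
  only-zero : ∀ i → T (g i) → i ≡ zero
  only-zero zero    _  = refl
  only-zero (suc i) gi = contradiction gi (count≡0⇒¬T (suc-injective c) i)
count≡1⇒unique {suc n} {g} c {zero}  {_}     gj gk | false = ⊥-elim (subst T g0 gj)
count≡1⇒unique {suc n} {g} c {suc j} {zero}  gj gk | false = ⊥-elim (subst T g0 gk)
count≡1⇒unique {suc n} {g} c {suc j} {suc k} gj gk | false = cong suc (count≡1⇒unique c gj gk)

length-filterᵇ-tabulate : ∀ {A : Set} {n} (g : A → Bool) (f : Fin n → A) →
                          length (filterᵇ g (List.tabulate f)) ≡ count (g ∘ f)
length-filterᵇ-tabulate {n = zero}  g f = refl
length-filterᵇ-tabulate {n = suc n} g f with g (f zero)
... | true  = cong suc (length-filterᵇ-tabulate g (f ∘ suc))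
... | false = length-filterᵇ-tabulate g (f ∘ suc)

length-cartesianProductWith : ∀ {A B C : Set} (f : A → B → C) xs ys →
  length (cartesianProductWith f xs ys) ≡ length xs ℕ.* length ys
length-cartesianProductWith f []       ys = refl
length-cartesianProductWith f (x ∷ xs) ys =
  trans (length-++ (List.map (f x) ys)) (cong₂ ℕ._+_ (length-map (f x) ys) (length-cartesianProductWith f xs ys))

∈⇒length-nonZero : ∀ {A : Set} {x : A} {xs} → x ∈ xs → NonZero (length xs)
∈⇒length-nonZero (here _)  = _
∈⇒length-nonZero (there _) = _

↭-unique : ∀ {A : Set} {xs ys : List A} → Unique xs → Unique ys → (∀ {z} → z ∈ xs ⇔ z ∈ ys) → xs ↭ ys
↭-unique xs! ys! xs≈ys = ∼bag⇒↭ (unique∧set⇒bag xs! ys! xs≈ys)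

sumℚ : ∀ {A : Set} → (A → ℚ) → List A → ℚ
sumℚ f xs = List.foldr _+_ 0ℚ (List.map f xs)

sumℚ-cong : ∀ {A : Set} {f g : A → ℚ} xs → (∀ {x} → x ∈ xs → f x ≡ g x) → sumℚ f xs ≡ sumℚ g xs
sumℚ-cong []       f≗g = refl
sumℚ-cong (x ∷ xs) f≗g = cong₂ _+_ (f≗g (here refl)) (sumℚ-cong xs (f≗g ∘ there))

sumℚ-++ : ∀ {A : Set} (f : A → ℚ) xs ys → sumℚ f (xs ++ ys) ≡ sumℚ f xs + sumℚ f ys
sumℚ-++ f []       ys = sym (+-identityˡ _)
sumℚ-++ f (x ∷ xs) ys = trans (cong (_+_ (f x)) (sumℚ-++ f xs ys)) (sym (+-assoc (f x) _ _))

sumℚ-↭ : ∀ {A : Set} (f : A → ℚ) {xs ys} → xs ↭ ys → sumℚ f xs ≡ sumℚ f ys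
sumℚ-↭ f p = foldr-commMonoid (setoid ℚ) +-0-isCommutativeMonoid (↭⇒↭ₛ (↭.map⁺ f p))

sumℚ-cartesianProductWith : ∀ {A B C : Set} (f : C → ℚ) (g : A → B → C) xs ys →
  sumℚ f (cartesianProductWith g xs ys) ≡ sumℚ (λ x → sumℚ f (List.map (g x) ys)) xs
sumℚ-cartesianProductWith f g []       ys = refl
sumℚ-cartesianProductWith f g (x ∷ xs) ys =
  trans (sumℚ-++ f (List.map (g x) ys) _)
        (cong (_+_ (sumℚ f (List.map (g x) ys))) (sumℚ-cartesianProductWith f g xs ys))

toℚᵘ-ℤ→ℚ : ∀ i → toℚᵘ (ℤ→ℚ i) ℚᵘ.≃ ℚᵘ.mkℚᵘ i 0
toℚᵘ-ℤ→ℚ i = toℚᵘ-fromℚᵘ (ℚᵘ.mkℚᵘ i 0)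

ℤ→ℚ-+ : ∀ i j → ℤ→ℚ (i ℤ.+ j) ≡ ℤ→ℚ i + ℤ→ℚ j
ℤ→ℚ-+ i j = toℚᵘ-injective (begin
  toℚᵘ (ℤ→ℚ (i ℤ.+ j))             ≈⟨ toℚᵘ-ℤ→ℚ (i ℤ.+ j) ⟩
  ℚᵘ.mkℚᵘ (i ℤ.+ j) 0               ≈⟨ ℚᵘ.*≡* (cong (ℤ._* + 1) numerator) ⟩
  ℚᵘ.mkℚᵘ i 0 ℚᵘ.+ ℚᵘ.mkℚᵘ j 0      ≈⟨ ℚᵘ.+-cong (toℚᵘ-ℤ→ℚ i) (toℚᵘ-ℤ→ℚ j) ⟨
  toℚᵘ (ℤ→ℚ i) ℚᵘ.+ toℚᵘ (ℤ→ℚ j)    ≈⟨ toℚᵘ-homo-+ (ℤ→ℚ i) (ℤ→ℚ j) ⟨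
  toℚᵘ (ℤ→ℚ i + ℤ→ℚ j)             ∎)
  where
  open ℚᵘ.≃-Reasoning
  numerator : i ℤ.+ j ≡ i ℤ.* + 1 ℤ.+ j ℤ.* + 1
  numerator = sym (cong₂ ℤ._+_ (ℤ.*-identityʳ i) (ℤ.*-identityʳ j))

ℤ→ℚ-* : ∀ i j → ℤ→ℚ (i ℤ.* j) ≡ ℤ→ℚ i * ℤ→ℚ j
ℤ→ℚ-* i j = toℚᵘ-injective (begin
  toℚᵘ (ℤ→ℚ (i ℤ.* j))             ≈⟨ toℚᵘ-ℤ→ℚ (i ℤ.* j) ⟩
  ℚᵘ.mkℚᵘ i 0 ℚᵘ.* ℚᵘ.mkℚᵘ j 0      ≈⟨ ℚᵘ.*-cong (toℚᵘ-ℤ→ℚ i) (toℚᵘ-ℤ→ℚ j) ⟨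
  toℚᵘ (ℤ→ℚ i) ℚᵘ.* toℚᵘ (ℤ→ℚ j)    ≈⟨ toℚᵘ-homo-* (ℤ→ℚ i) (ℤ→ℚ j) ⟨
  toℚᵘ (ℤ→ℚ i * ℤ→ℚ j)             ∎)
  where open ℚᵘ.≃-Reasoning

ℤ→ℚ-neg : ∀ i → ℤ→ℚ (ℤ.- i) ≡ ℚ.- ℤ→ℚ i
ℤ→ℚ-neg i = toℚᵘ-injective (begin
  toℚᵘ (ℤ→ℚ (ℤ.- i))   ≈⟨ toℚᵘ-ℤ→ℚ (ℤ.- i) ⟩
  ℚᵘ.- ℚᵘ.mkℚᵘ i 0      ≈⟨ ℚᵘ.-‿cong (toℚᵘ-ℤ→ℚ i) ⟨
  ℚᵘ.- toℚᵘ (ℤ→ℚ i)     ≈⟨ toℚᵘ-homo‿- (ℤ→ℚ i) ⟨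
  toℚᵘ (ℚ.- ℤ→ℚ i)     ∎)
  where open ℚᵘ.≃-Reasoning

ℤ→ℚ-- : ∀ i j → ℤ→ℚ (i - j) ≡ ℤ→ℚ i ℚ.- ℤ→ℚ j
ℤ→ℚ-- i j = trans (ℤ→ℚ-+ i (ℤ.- j)) (cong (_+_ (ℤ→ℚ i)) (ℤ→ℚ-neg j))

ℕ→ℚ-+ : ∀ m n → ℕ→ℚ (m ℕ.+ n) ≡ ℕ→ℚ m + ℕ→ℚ n
ℕ→ℚ-+ m n = trans (cong ℤ→ℚ (ℤ.pos-+ m n)) (ℤ→ℚ-+ (+ m) (+ n))

ℕ→ℚ-* : ∀ m n → ℕ→ℚ (m ℕ.* n) ≡ ℕ→ℚ m * ℕ→ℚ n
ℕ→ℚ-* m n = trans (cong ℤ→ℚ (ℤ.pos-* m n)) (ℤ→ℚ-* (+ m) (+ n))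

ℕ→ℚ-*-inv : ∀ n .{{_ : NonZero n}} → ℕ→ℚ n * inv n ≡ 1ℚ
ℕ→ℚ-*-inv (suc k) = toℚᵘ-injective (begin
  toℚᵘ (ℕ→ℚ (suc k) * inv (suc k))
    ≈⟨ toℚᵘ-homo-* (ℕ→ℚ (suc k)) (inv (suc k)) ⟩
  toℚᵘ (ℕ→ℚ (suc k)) ℚᵘ.* toℚᵘ (inv (suc k))
    ≈⟨ ℚᵘ.*-cong (toℚᵘ-ℤ→ℚ (+ suc k)) (toℚᵘ-fromℚᵘ (ℚᵘ.mkℚᵘ (+ 1) k)) ⟩
  ℚᵘ.mkℚᵘ (+ suc k) 0 ℚᵘ.* ℚᵘ.mkℚᵘ (+ 1) k
    ≈⟨ ℚᵘ.*≡* (trans (ℤ.*-identityʳ _) (trans (ℤ.*-identityʳ _) (sym (trans (ℤ.*-identityˡ _) suc-k)))) ⟩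
  toℚᵘ 1ℚ ∎)
  where
  open ℚᵘ.≃-Reasoning
  suc-k : + (1 ℕ.* suc k) ≡ + suc k
  suc-k = cong +_ (ℕ.*-identityˡ (suc k))

inv-unique : ∀ n .{{_ : NonZero n}} {x} → ℕ→ℚ n * x ≡ 1ℚ → x ≡ inv n
inv-unique n {x} nx≡1 = begin
  x                         ≡⟨ *-identityˡ x ⟨
  1ℚ * x                    ≡⟨ cong (_* x) (trans (*-comm (inv n) (ℕ→ℚ n)) (ℕ→ℚ-*-inv n)) ⟨
  (inv n * ℕ→ℚ n) * x       ≡⟨ *-assoc (inv n) _ x ⟩
  inv n * (ℕ→ℚ n * x)       ≡⟨ cong (inv n *_) nx≡1 ⟩
  inv n * 1ℚ                ≡⟨ *-identityʳ (inv n) ⟩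
  inv n                     ∎
  where open ≡-Reasoning

inv-* : ∀ m n .{{_ : NonZero m}} .{{_ : NonZero n}} → inv (m ℕ.* n) ≡ inv m * inv n
inv-* m n = sym (inv-unique (m ℕ.* n) {{m*n≢0 m n}} (begin
  ℕ→ℚ (m ℕ.* n) * (inv m * inv n)          ≡⟨ cong (_* (inv m * inv n)) (ℕ→ℚ-* m n) ⟩
  (ℕ→ℚ m * ℕ→ℚ n) * (inv m * inv n)        ≡⟨ *-interchange (ℕ→ℚ m) _ _ _ ⟩
  (ℕ→ℚ m * inv m) * (ℕ→ℚ n * inv n)        ≡⟨ cong₂ _*_ (ℕ→ℚ-*-inv m) (ℕ→ℚ-*-inv n) ⟩
  1ℚ * 1ℚ                                  ≡⟨ *-identityˡ 1ℚ ⟩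
  1ℚ                                       ∎))
  where
  open ≡-Reasoning
  *-interchange : ∀ a b c d → (a * b) * (c * d) ≡ (a * c) * (b * d)
  *-interchange = solve 4 (λ a b c d → (a :* b) :* (c :* d) := (a :* c) :* (b :* d)) refl
    where open +-*-Solver

affine-mean : ∀ l s .{{_ : NonZero l}} .{{_ : NonZero s}} A S B →
              (A * S + ℕ→ℚ l * B) * inv (l ℕ.* s) ≡ (A * inv s) * (S * inv l) + B * inv s
affine-mean l s A S B = begin
  (A * S + ℕ→ℚ l * B) * inv (l ℕ.* s)
    ≡⟨ cong (_*_ (A * S + ℕ→ℚ l * B)) (inv-* l s) ⟩
  (A * S + ℕ→ℚ l * B) * (inv l * inv s)
    ≡⟨ regroup A S (ℕ→ℚ l) B (inv l) (inv s) ⟩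
  (A * inv s) * (S * inv l) + (B * inv s) * (ℕ→ℚ l * inv l)
    ≡⟨ cong (λ t → (A * inv s) * (S * inv l) + (B * inv s) * t) (ℕ→ℚ-*-inv l) ⟩
  (A * inv s) * (S * inv l) + (B * inv s) * 1ℚ
    ≡⟨ cong (_+_ ((A * inv s) * (S * inv l))) (*-identityʳ (B * inv s)) ⟩
  (A * inv s) * (S * inv l) + B * inv s ∎
  where
  open ≡-Reasoning
  open +-*-Solver
  regroup : ∀ A S ℓ B i j → (A * S + ℓ * B) * (i * j) ≡ (A * j) * (S * i) + (B * j) * (ℓ * i)
  regroup = solve 6 (λ A S ℓ B i j →
    (A :* S :+ ℓ :* B) :* (i :* j) := (A :* j) :* (S :* i) :+ (B :* j) :* (ℓ :* i)) refl

sumℚ-const : ∀ {A : Set} (c : ℚ) (xs : List A) → sumℚ (λ _ → c) xs ≡ ℕ→ℚ (length xs) * c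
sumℚ-const c []       = sym (*-zeroˡ c)
sumℚ-const c (x ∷ xs) = begin
  c + sumℚ (λ _ → c) xs           ≡⟨ cong (_+_ c) (sumℚ-const c xs) ⟩
  c + ℕ→ℚ (length xs) * c         ≡⟨ solve 2 (λ c l → c :+ l :* c := (con 1ℚ :+ l) :* c) refl c (ℕ→ℚ (length xs)) ⟩
  (1ℚ + ℕ→ℚ (length xs)) * c      ≡⟨ cong (_* c) (ℕ→ℚ-+ 1 (length xs)) ⟨
  ℕ→ℚ (suc (length xs)) * c       ∎
  where
  open ≡-Reasoning
  open +-*-Solver

sumℚ-affine : ∀ {A : Set} (u v : ℚ) (f : A → ℚ) xs →
              sumℚ (λ x → u * f x + v) xs ≡ u * sumℚ f xs + ℕ→ℚ (length xs) * v
sumℚ-affine u v f []       = solve 2 (λ u v → con 0ℚ := u :* con 0ℚ :+ con 0ℚ :* v) refl u v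
  where open +-*-Solver
sumℚ-affine u v f (x ∷ xs) = begin
  (u * f x + v) + sumℚ (λ x → u * f x + v) xs
    ≡⟨ cong (_+_ (u * f x + v)) (sumℚ-affine u v f xs) ⟩
  (u * f x + v) + (u * sumℚ f xs + l * v)
    ≡⟨ solve 5 (λ u v y s l → (u :* y :+ v) :+ (u :* s :+ l :* v) := u :* (y :+ s) :+ (con 1ℚ :+ l) :* v)
               refl u v (f x) (sumℚ f xs) l ⟩
  u * (f x + sumℚ f xs) + (1ℚ + l) * v
    ≡⟨ cong (λ l → u * (f x + sumℚ f xs) + l * v) (ℕ→ℚ-+ 1 (length xs)) ⟨
  u * (f x + sumℚ f xs) + ℕ→ℚ (suc (length xs)) * v ∎
  where
  open ≡-Reasoning
  open +-*-Solver
  l = ℕ→ℚ (length xs)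

sumℚ-two-valued : ∀ {A : Set} → DecidableEquality A → ∀ {xs ys : List A} (f : A → ℚ) {u v} →
  Unique xs → Unique ys → (∀ {x} → x ∈ xs → x ∈ ys) →
  (∀ {y} → y ∈ xs → f y ≡ u) → (∀ {y} → y ∈ ys → y ∉ xs → f y ≡ v) →
  sumℚ f ys ≡ ℕ→ℚ (length xs) * u + (ℕ→ℚ (length ys) ℚ.- ℕ→ℚ (length xs)) * v
sumℚ-two-valued _≟_ {xs} {ys} f {u} {v} xs! ys! xs⊆ys on-xs off-xs = begin
  sumℚ f ys
    ≡⟨ sumℚ-↭ f ys↭ ⟩
  sumℚ f (xs ++ rest)
    ≡⟨ sumℚ-++ f xs rest ⟩
  sumℚ f xs + sumℚ f rest
    ≡⟨ cong₂ _+_ (sumℚ-const-on xs on-xs) (sumℚ-const-on rest (uncurry off-xs ∘ ∈rest⁻)) ⟩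
  x * u + r * v
    ≡⟨ solve 4 (λ x r u v → x :* u :+ r :* v := x :* u :+ ((x :+ r) :- x) :* v) refl x r u v ⟩
  x * u + ((x + r) ℚ.- x) * v
    ≡⟨ cong (λ l → x * u + (l ℚ.- x) * v) |ys|≡ ⟨
  x * u + (ℕ→ℚ (length ys) ℚ.- x) * v ∎
  where
  open ≡-Reasoning
  open +-*-Solver
  open DecMembership _≟_ using (_∈?_; _∉?_)
  rest = filter (_∉? xs) ys
  x = ℕ→ℚ (length xs)
  r = ℕ→ℚ (length rest)
  ∈rest⁻ : ∀ {z} → z ∈ rest → z ∈ ys × z ∉ xs
  ∈rest⁻ = ∈-filter⁻ (_∉? xs) {xs = ys}
  sumℚ-const-on : ∀ {c} zs → (∀ {z} → z ∈ zs → f z ≡ c) → sumℚ f zs ≡ ℕ→ℚ (length zs) * c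
  sumℚ-const-on {c} zs f≡c = trans (sumℚ-cong zs f≡c) (sumℚ-const c zs)
  ys↭ : ys ↭ xs ++ rest
  ys↭ = ↭-unique ys!
    (Unique.++⁺ xs! (Unique.filter⁺ (_∉? xs) {ys} ys!) (λ (z∈xs , z∈rest) → proj₂ (∈rest⁻ z∈rest) z∈xs))
    (mk⇔ split (λ z∈ → [ xs⊆ys , proj₁ ∘ ∈rest⁻ ]′ (∈-++⁻ xs z∈)))
    where
    split : ∀ {z} → z ∈ ys → z ∈ xs ++ rest
    split {z} z∈ys with z ∈? xs
    ... | yes z∈xs = ∈-++⁺ˡ z∈xs
    ... | no  z∉xs = ∈-++⁺ʳ xs (∈-filter⁺ (_∉? xs) z∈ys z∉xs)
  |ys|≡ : ℕ→ℚ (length ys) ≡ x + r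
  |ys|≡ = trans (cong ℕ→ℚ (trans (↭.↭-length ys↭) (length-++ xs))) (ℕ→ℚ-+ (length xs) (length rest))

-- Inserting an adjacent pair

skip : ℕ → ℕ → ℕ
skip a p = if p <ᵇ a then p else suc (suc p)

φ-adjacent : ∀ a p → φ a (suc a) p ≡ skip a p
φ-adjacent a p with p <ᵇ a
... | true  = refl
... | false = refl

skip-cases : ∀ a p → (p < a × skip a p ≡ p) ⊎ (a ≤ p × skip a p ≡ suc (suc p))
skip-cases a p with p <ᵇ a | <ᵇ-reflects-< p a
... | true  | ofʸ p<a = inj₁ (p<a , refl)
... | false | ofⁿ p≮a = inj₂ (≮⇒≥ p≮a , refl)

skip-below : ∀ {a p} → p < a → skip a p ≡ p
skip-below {a} {p} p<a with skip-cases a p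
... | inj₁ (_ , s≡p) = s≡p
... | inj₂ (a≤p , _) = contradiction (<-≤-trans p<a a≤p) (<-irrefl refl)

skip-above : ∀ {a p} → a ≤ p → skip a p ≡ suc (suc p)
skip-above {a} {p} a≤p with skip-cases a p
... | inj₁ (p<a , _) = contradiction (<-≤-trans p<a a≤p) (<-irrefl refl)
... | inj₂ (_ , s≡2+p) = s≡2+p

skip-mono-< : ∀ a {p q} → p < q → skip a p < skip a q
skip-mono-< a {p} {q} p<q with skip-cases a p | skip-cases a q
... | inj₁ (_ , sp) | inj₁ (_ , sq) rewrite sp | sq = p<q
... | inj₁ (p<a , sp) | inj₂ (a≤q , sq) rewrite sp | sq = <-trans (<-≤-trans p<a a≤q) (m<n⇒m<1+n (n<1+n q))
... | inj₂ (a≤p , _) | inj₁ (q<a , _) = contradiction (<-trans (<-≤-trans q<a a≤p) p<q) (<-irrefl refl)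
... | inj₂ (_ , sp) | inj₂ (_ , sq) rewrite sp | sq = s<s (s<s p<q)

skip-cancel-< : ∀ a {p q} → skip a p < skip a q → p < q
skip-cancel-< a {p} {q} sp<sq with <-cmp p q
... | tri< p<q _ _ = p<q
... | tri≈ _ refl _ = contradiction sp<sq (<-irrefl refl)
... | tri> _ _ q<p = contradiction (<-trans sp<sq (skip-mono-< a q<p)) (<-irrefl refl)

skip-mono-<′ : ∀ a {x y u v} → x ≡ skip a u → y ≡ skip a v → u < v → x < y
skip-mono-<′ a refl refl = skip-mono-< a

skip-cancel-<′ : ∀ a {x y u v} → x ≡ skip a u → y ≡ skip a v → x < y → u < v
skip-cancel-<′ a refl refl = skip-cancel-< a

skip-injective : ∀ a {p q} → skip a p ≡ skip a q → p ≡ q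
skip-injective a {p} {q} sp≡sq with <-cmp p q
... | tri< p<q _ _ = contradiction sp≡sq (<⇒≢ (skip-mono-< a p<q))
... | tri≈ _ p≡q _ = p≡q
... | tri> _ _ q<p = contradiction sp≡sq (>⇒≢ (skip-mono-< a q<p))

skip≢ : ∀ a p → skip a p ≢ a
skip≢ a p with skip-cases a p
... | inj₁ (p<a , sp) = <⇒≢ (subst (_< a) (sym sp) p<a)
... | inj₂ (a≤p , sp) = >⇒≢ (subst (a <_) (sym sp) (s≤s (m≤n⇒m≤1+n a≤p)))

skip≢1+ : ∀ a p → skip a p ≢ suc a
skip≢1+ a p with skip-cases a p
... | inj₁ (p<a , sp) = <⇒≢ (subst (_< suc a) (sym sp) (m<n⇒m<1+n p<a))
... | inj₂ (a≤p , sp) = >⇒≢ (subst (suc a <_) (sym sp) (s<s (s≤s a≤p)))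

skip-bounded : ∀ a {p N} → p < N → skip a p < suc (suc N)
skip-bounded a {p} {N} p<N with skip-cases a p
... | inj₁ (_ , sp) rewrite sp = m<n⇒m<1+n (m<n⇒m<1+n p<N)
... | inj₂ (_ , sp) rewrite sp = s<s (s<s p<N)

skip-surjective : ∀ {a N} i → a ≤ N → i < suc (suc N) → i ≢ a → i ≢ suc a →
                  Σ ℕ λ p → p < N × skip a p ≡ i
skip-surjective {a} i a≤N i<2+N i≢a i≢1+a with <-cmp i a
... | tri< i<a _ _ = i , <-≤-trans i<a a≤N , skip-below i<a
... | tri≈ _ i≡a _ = contradiction i≡a i≢a
... | tri> _ _ a<i = above i (≤∧≢⇒< a<i (i≢1+a ∘ sym)) i<2+N
  where
  above : ∀ {N} i → suc (suc a) ≤ i → i < suc (suc N) → Σ ℕ λ p → p < N × skip a p ≡ i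
  above (suc (suc p)) (s≤s (s≤s a≤p)) (s<s (s<s p<N)) = p , p<N , skip-above a≤p

≡ᵇ-skip : ∀ a x y → (skip a x ≡ᵇ skip a y) ≡ (x ≡ᵇ y)
≡ᵇ-skip a x y = det (fromEquivalence (skip-injective a ∘ ≡ᵇ⇒≡ _ _) (≡⇒≡ᵇ _ _ ∘ cong (skip a)))
                    (≡ᵇ-reflects-≡ x y)

touches : ∀ {n} → (Fin n → ℕ) → (Fin n → ℕ) → ℕ → Fin n → Bool
touches L H i k = (L k ≡ᵇ i) ∨ (H k ≡ᵇ i)

touches-reflects : ∀ {n} (L H : Fin n → ℕ) i k → Reflects (L k ≡ i ⊎ H k ≡ i) (touches L H i k)
touches-reflects L H i k = ≡ᵇ-reflects-≡ (L k) i ⊎-reflects ≡ᵇ-reflects-≡ (H k) i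

touches⁺ : ∀ {n} {L H : Fin n → ℕ} {i k} → L k ≡ i ⊎ H k ≡ i → T (touches L H i k)
touches⁺ {L = L} {H} {i} {k} = reflects⁺ (touches-reflects L H i k)

touches⁻ : ∀ {n} {L H : Fin n → ℕ} {i k} → T (touches L H i k) → L k ≡ i ⊎ H k ≡ i
touches⁻ {L = L} {H} {i} {k} = reflects⁻ (touches-reflects L H i k)

-- validᵇ for blocks {L k < H k}, labelled by k, of a pairing of {0,…,N-1}.
record IsMonotoneNCPairing (n N : ℕ) (L H : Fin n → ℕ) : Set where
  field
    lo<hi        : ∀ k → L k < H k
    touchedOnce  : ∀ i → i < N → count (touches L H i) ≡ 1
    noncrossing  : ∀ j k → ¬ (L j < L k × L k < H j × H j < H k)
    monotone     : ∀ j k → L j < L k × H k < H j → toℕ j < toℕ k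

  touched-unique : ∀ {i j k} → i < N → L j ≡ i ⊎ H j ≡ i → L k ≡ i ⊎ H k ≡ i → j ≡ k
  touched-unique i<N j↦i k↦i =
    count≡1⇒unique (touchedOnce _ i<N) (touches⁺ {L = L} {H} j↦i) (touches⁺ {L = L} {H} k↦i)

-- x arises from ρ by inserting J(x) = {a, 1+a} as the top-labelled block, i.e. ρ = pp x.
record IsInsertion {m} (a : ℕ) (Lρ Hρ : Fin m → ℕ) (Lx Hx : Fin (suc m) → ℕ) : Set where
  field
    lo-inject₁ : ∀ k → Lx (inject₁ k) ≡ skip a (Lρ k)
    hi-inject₁ : ∀ k → Hx (inject₁ k) ≡ skip a (Hρ k)
    lo-top     : Lx (fromℕ m) ≡ a
    hi-top     : Hx (fromℕ m) ≡ suc a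

module Insertion {m a} {Lρ Hρ : Fin m → ℕ} {Lx Hx : Fin (suc m) → ℕ} (ins : IsInsertion a Lρ Hρ Lx Hx) where
  open IsInsertion ins

  touches-skip-inject₁ : ∀ p k → touches Lx Hx (skip a p) (inject₁ k) ≡ touches Lρ Hρ p k
  touches-skip-inject₁ p k rewrite lo-inject₁ k | hi-inject₁ k =
    cong₂ _∨_ (≡ᵇ-skip a (Lρ k) p) (≡ᵇ-skip a (Hρ k) p)

  count-touches-skip : ∀ p → count (touches Lx Hx (skip a p)) ≡ count (touches Lρ Hρ p)
  count-touches-skip p = begin
    count (touches Lx Hx (skip a p))
      ≡⟨ count-last (touches Lx Hx (skip a p)) ⟩
    count (touches Lx Hx (skip a p) ∘ inject₁) ℕ.+ (if touches Lx Hx (skip a p) (fromℕ m) then 1 else 0)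
      ≡⟨ cong₂ ℕ._+_ (count-cong (touches-skip-inject₁ p)) (cong (λ b → if b then 1 else 0) top-untouched) ⟩
    count (touches Lρ Hρ p) ℕ.+ 0
      ≡⟨ ℕ.+-identityʳ _ ⟩
    count (touches Lρ Hρ p) ∎
    where
    open ≡-Reasoning
    top-untouched : touches Lx Hx (skip a p) (fromℕ m) ≡ false
    top-untouched = det (touches-reflects Lx Hx (skip a p) (fromℕ m)) (ofⁿ λ
      { (inj₁ e) → skip≢ a p (trans (sym e) lo-top)
      ; (inj₂ e) → skip≢1+ a p (trans (sym e) hi-top) })

  count-touches-gap : ∀ {i} → i ≡ a ⊎ i ≡ suc a → count (touches Lx Hx i) ≡ 1
  count-touches-gap {i} i∈gap = begin
    count (touches Lx Hx i)
      ≡⟨ count-last (touches Lx Hx i) ⟩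
    count (touches Lx Hx i ∘ inject₁) ℕ.+ (if touches Lx Hx i (fromℕ m) then 1 else 0)
      ≡⟨ cong₂ ℕ._+_ (count-none others-untouched) (cong (λ b → if b then 1 else 0) top-touched) ⟩
    1 ∎
    where
    open ≡-Reasoning
    top-touched : touches Lx Hx i (fromℕ m) ≡ true
    top-touched = det (touches-reflects Lx Hx i (fromℕ m))
                      (ofʸ ([ inj₁ ∘ trans lo-top ∘ sym , inj₂ ∘ trans hi-top ∘ sym ] i∈gap))
    avoids : ∀ p → skip a p ≢ i
    avoids p = [ (λ { refl → skip≢ a p }) , (λ { refl → skip≢1+ a p }) ] i∈gap
    others-untouched : ∀ k → touches Lx Hx i (inject₁ k) ≡ false
    others-untouched k = det (touches-reflects Lx Hx i (inject₁ k)) (ofⁿ λ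
      { (inj₁ e) → avoids (Lρ k) (trans (sym (lo-inject₁ k)) e)
      ; (inj₂ e) → avoids (Hρ k) (trans (sym (hi-inject₁ k)) e) })

  insert-lo<hi : (∀ k → Lρ k < Hρ k) → ∀ k → Lx k < Hx k
  insert-lo<hi lo<hi k with view k
  ... | ‵fromℕ     = subst₂ _<_ (sym lo-top) (sym hi-top) (n<1+n a)
  ... | ‵inject₁ u = skip-mono-<′ a (lo-inject₁ u) (hi-inject₁ u) (lo<hi u)

  insert-touchedOnce : ∀ {N} → a ≤ N → (∀ p → p < N → count (touches Lρ Hρ p) ≡ 1) →
                       ∀ i → i < suc (suc N) → count (touches Lx Hx i) ≡ 1
  insert-touchedOnce a≤N touchedOnce i i<2+N with i ≟ a | i ≟ suc a
  ... | yes i≡a | _         = count-touches-gap (inj₁ i≡a)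
  ... | no _    | yes i≡1+a = count-touches-gap (inj₂ i≡1+a)
  ... | no i≢a  | no i≢1+a  =
    let p , p<N , p↦i = skip-surjective i a≤N i<2+N i≢a i≢1+a
    in subst (λ i → count (touches Lx Hx i) ≡ 1) p↦i (trans (count-touches-skip p) (touchedOnce p p<N))

  insert-noncrossing : (∀ j k → ¬ (Lρ j < Lρ k × Lρ k < Hρ j × Hρ j < Hρ k)) →
                       ∀ j k → ¬ (Lx j < Lx k × Lx k < Hx j × Hx j < Hx k)
  insert-noncrossing noncrossing j k with view j | view k
  ... | ‵inject₁ u | ‵inject₁ v = λ (h₁ , h₂ , h₃) → noncrossing u v
    ( skip-cancel-<′ a (lo-inject₁ u) (lo-inject₁ v) h₁
    , skip-cancel-<′ a (lo-inject₁ v) (hi-inject₁ u) h₂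
    , skip-cancel-<′ a (hi-inject₁ u) (hi-inject₁ v) h₃ )
  ... | ‵inject₁ u | ‵fromℕ = λ (_ , h₂ , h₃) →
    no-ℕ-between (subst (_< Hx (inject₁ u)) lo-top h₂) (subst (Hx (inject₁ u) <_) hi-top h₃)
  ... | ‵fromℕ | ‵inject₁ v = λ (h₁ , h₂ , _) →
    no-ℕ-between (subst (_< Lx (inject₁ v)) lo-top h₁) (subst (Lx (inject₁ v) <_) hi-top h₂)
  ... | ‵fromℕ | ‵fromℕ = λ (h₁ , _) → <-irrefl refl h₁

  insert-monotone : (∀ k → Lρ k < Hρ k) → (∀ j k → Lρ j < Lρ k × Hρ k < Hρ j → toℕ j < toℕ k) →
                    ∀ j k → Lx j < Lx k × Hx k < Hx j → toℕ j < toℕ k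
  insert-monotone lo<hi monotone j k with view j | view k
  ... | ‵inject₁ u | ‵inject₁ v = λ (h₁ , h₂) →
    subst₂ _<_ (sym (toℕ-inject₁ u)) (sym (toℕ-inject₁ v)) (monotone u v
      (skip-cancel-<′ a (lo-inject₁ u) (lo-inject₁ v) h₁ , skip-cancel-<′ a (hi-inject₁ v) (hi-inject₁ u) h₂))
  ... | ‵inject₁ u | ‵fromℕ = λ _ → toℕ-inject₁<toℕ-fromℕ u
  ... | ‵fromℕ | ‵inject₁ v = λ (h₁ , h₂) → ⊥-elim (no-ℕ-between
    (subst (_< Hx (inject₁ v)) lo-top (<-trans h₁ (insert-lo<hi lo<hi (inject₁ v))))
    (subst (Hx (inject₁ v) <_) hi-top h₂))
  ... | ‵fromℕ | ‵fromℕ = λ (h₁ , _) → ⊥-elim (<-irrefl refl h₁)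

  insert-valid : ∀ {N} → a ≤ N → IsMonotoneNCPairing m N Lρ Hρ →
                 IsMonotoneNCPairing (suc m) (suc (suc N)) Lx Hx
  insert-valid a≤N ρ-valid = record
    { lo<hi       = insert-lo<hi lo<hi
    ; touchedOnce = insert-touchedOnce a≤N touchedOnce
    ; noncrossing = insert-noncrossing noncrossing
    ; monotone    = insert-monotone lo<hi monotone }
    where open IsMonotoneNCPairing ρ-valid

  remove-valid : ∀ {N} → IsMonotoneNCPairing (suc m) (suc (suc N)) Lx Hx → IsMonotoneNCPairing m N Lρ Hρ
  remove-valid x-valid = record
    { lo<hi = λ k → skip-cancel-<′ a (lo-inject₁ k) (hi-inject₁ k) (lo<hi (inject₁ k))
    ; touchedOnce = λ p p<N → trans (sym (count-touches-skip p)) (touchedOnce (skip a p) (skip-bounded a p<N))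
    ; noncrossing = λ j k (h₁ , h₂ , h₃) → noncrossing (inject₁ j) (inject₁ k)
        ( skip-mono-<′ a (lo-inject₁ j) (lo-inject₁ k) h₁
        , skip-mono-<′ a (lo-inject₁ k) (hi-inject₁ j) h₂
        , skip-mono-<′ a (hi-inject₁ j) (hi-inject₁ k) h₃ )
    ; monotone = λ j k (h₁ , h₂) → subst₂ _<_ (toℕ-inject₁ j) (toℕ-inject₁ k)
        (monotone (inject₁ j) (inject₁ k)
          (skip-mono-<′ a (lo-inject₁ j) (lo-inject₁ k) h₁ , skip-mono-<′ a (hi-inject₁ k) (hi-inject₁ j) h₂))
    }
    where open IsMonotoneNCPairing x-valid

module TopBlock {m N} {Lx Hx : Fin (suc m) → ℕ} (valid : IsMonotoneNCPairing (suc m) N Lx Hx)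
                (top<N : Hx (fromℕ m) < N) where
  open IsMonotoneNCPairing valid

  private
    t = fromℕ m
    a = Lx t
    b = Hx t
    a<N : a < N
    a<N = <-trans (lo<hi t) top<N

  top-label-max : ∀ k → ¬ (toℕ t < toℕ k)
  top-label-max k t<k = no-ℕ-between (subst (_< toℕ k) (toℕ-fromℕ m) t<k) (toℕ<n k)

  lo-inside-top : ∀ k → a < Lx k → Lx k < b → ⊥
  lo-inside-top k a<ℓ ℓ<b with <-cmp (Hx k) b
  ... | tri< h<b _ _ = top-label-max k (monotone t k (a<ℓ , h<b))
  ... | tri> _ _ b<h = noncrossing t k (a<ℓ , ℓ<b , b<h)
  ... | tri≈ _ h≡b _ with touched-unique top<N (inj₂ h≡b) (inj₂ refl)
  ...   | refl = <-irrefl refl a<ℓ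

  hi-inside-top : ∀ k → a < Hx k → Hx k < b → ⊥
  hi-inside-top k a<h h<b with <-cmp (Lx k) a
  ... | tri< ℓ<a _ _ = noncrossing k t (ℓ<a , a<h , h<b)
  ... | tri> _ _ a<ℓ = lo-inside-top k a<ℓ (<-trans (lo<hi k) h<b)
  ... | tri≈ _ ℓ≡a _ with touched-unique a<N (inj₁ ℓ≡a) (inj₁ refl)
  ...   | refl = <-irrefl refl h<b

  top-adjacent : b ≡ suc a
  top-adjacent with <-cmp (suc a) b
  ... | tri≈ _ 1+a≡b _ = sym 1+a≡b
  ... | tri> _ _ b<1+a = ⊥-elim (no-ℕ-between (lo<hi t) b<1+a)
  ... | tri< 1+a<b _ _ =
    let k , hit = count≡1⇒∃ {g = touches Lx Hx (suc a)} (touchedOnce (suc a) (<-trans 1+a<b top<N))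
        inside = λ {x} (x≡1+a : x ≡ suc a) → subst (a <_) (sym x≡1+a) (n<1+n a) , subst (_< b) (sym x≡1+a) 1+a<b
    in ⊥-elim ([ uncurry (lo-inside-top k) ∘ inside , uncurry (hi-inside-top k) ∘ inside ] (touches⁻ {L = Lx} {Hx} hit))

  touching-gap⇒top : ∀ {i k} → i ≡ a ⊎ i ≡ suc a → Lx k ≡ i ⊎ Hx k ≡ i → k ≡ t
  touching-gap⇒top (inj₁ refl) k↦i = touched-unique a<N k↦i (inj₁ refl)
  touching-gap⇒top (inj₂ refl) k↦i =
    touched-unique (subst (_< N) top-adjacent top<N) k↦i (inj₂ top-adjacent)

  endpoint-avoids-gap : ∀ j {i} → Lx (inject₁ j) ≡ i ⊎ Hx (inject₁ j) ≡ i → i ≢ a × i ≢ suc a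
  endpoint-avoids-gap j e =
      (λ i≡a → fromℕ≢inject₁ (sym (touching-gap⇒top (inj₁ i≡a) e)))
    , (λ i≡1+a → fromℕ≢inject₁ (sym (touching-gap⇒top (inj₂ i≡1+a) e)))

-- Pair-parents and children in NC^(mton)_2

loᵥ hiᵥ : ∀ {n} → Vec (Block n) n → Fin n → ℕ
loᵥ bs k = lo (lookup bs k)
hiᵥ bs k = hi (lookup bs k)

IsValid : ∀ n → Vec (Block n) n → Set
IsValid n bs = IsMonotoneNCPairing n (2 ℕ.* n) (loᵥ bs) (hiᵥ bs)

validᵇ-reflects : ∀ n bs → Reflects (IsValid n bs) (validᵇ n bs)
validᵇ-reflects n bs = map-reflects
  (λ (lo<hi , touched , noncrossing , monotone) → record
     { lo<hi = lo<hi ; touchedOnce = touchedOnce-ℕ touched ; noncrossing = noncrossing ; monotone = monotone })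
  (λ v → let open IsMonotoneNCPairing v in
     lo<hi
     , (λ i → trans (length-filterᵇ-tabulate (touches L H (toℕ i)) id) (touchedOnce (toℕ i) (toℕ<n i)))
     , noncrossing , monotone)
  (all-tabulate-reflects id (λ k → <ᵇ-reflects-< (L k) (H k))
   ×-reflects all-tabulate-reflects id (λ i → ≡ᵇ-reflects-≡ _ 1)
   ×-reflects all-tabulate-reflects id (λ j → all-tabulate-reflects id (λ k →
                ¬-reflects (<ᵇ-reflects-< (L j) (L k) ×-reflects <ᵇ-reflects-< (L k) (H j)
                                                     ×-reflects <ᵇ-reflects-< (H j) (H k))))
   ×-reflects all-tabulate-reflects id (λ j → all-tabulate-reflects id (λ k →
                (<ᵇ-reflects-< (L j) (L k) ×-reflects <ᵇ-reflects-< (H k) (H j))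
                →-reflects <ᵇ-reflects-< (toℕ j) (toℕ k))))
  where
  L = loᵥ bs
  H = hiᵥ bs
  touchedOnce-ℕ : (∀ (i : Fin (2 ℕ.* n)) → length (filterᵇ (touches L H (toℕ i)) (allFin n)) ≡ 1) →
                ∀ i → i < 2 ℕ.* n → count (touches L H i) ≡ 1
  touchedOnce-ℕ touched i i<2n = subst (λ i → count (touches L H i) ≡ 1) (toℕ-fromℕ< i<2n)
    (trans (sym (length-filterᵇ-tabulate (touches L H (toℕ (fromℕ< i<2n))) id)) (touched (fromℕ< i<2n)))

Mon-valid : ∀ {n} (x : Mon n) → IsValid n (blocks x)
Mon-valid {n} (bs , ok) = reflects⁻ (validᵇ-reflects n bs) ok

mkMon : ∀ {n} (bs : Vec (Block n) n) → IsValid n bs → Mon n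
mkMon {n} bs v = bs , reflects⁺ (validᵇ-reflects n bs) v

blocks-injective : ∀ {n} {x y : Mon n} → blocks x ≡ blocks y → x ≡ y
blocks-injective {x = bs , p} {.bs , q} refl = cong (bs ,_) (T-irrelevant p q)

Mon-≡ : ∀ {n} {x y : Mon n} → (∀ k → loᵥ (blocks x) k ≡ loᵥ (blocks y) k) →
        (∀ k → hiᵥ (blocks x) k ≡ hiᵥ (blocks y) k) → x ≡ y
Mon-≡ lo≗ hi≗ = blocks-injective (lookup-ext λ k → cong₂ _,_ (toℕ-injective (lo≗ k)) (toℕ-injective (hi≗ k)))

Mon-≟ : ∀ {n} → DecidableEquality (Mon n)
Mon-≟ x y = map′ blocks-injective (cong blocks) (Vec.≡-dec (×.≡-dec Fin._≟_ Fin._≟_) (blocks x) (blocks y))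

valid-resize : ∀ {n N N′} {L H : Fin n → ℕ} → N ≡ N′ →
               IsMonotoneNCPairing n N L H → IsMonotoneNCPairing n N′ L H
valid-resize refl v = v

2*suc : ∀ m → 2 ℕ.* suc m ≡ suc (suc (2 ℕ.* m))
2*suc m = ℕ.*-suc 2 m

isPairParent⇒insertion : ∀ {m} x ρ → (top-adj : hiᵥ (blocks x) (fromℕ m) ≡ suc (loᵥ (blocks x) (fromℕ m))) →
  IsPairParent m x ρ →
  IsInsertion (loᵥ (blocks x) (fromℕ m)) (loᵥ (blocks ρ)) (hiᵥ (blocks ρ)) (loᵥ (blocks x)) (hiᵥ (blocks x))
isPairParent⇒insertion {m} x ρ top-adj pp = record
  { lo-inject₁ = λ k → trans (proj₁ (pp k)) (φ≡skip _)
  ; hi-inject₁ = λ k → trans (proj₂ (pp k)) (φ≡skip _)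
  ; lo-top = refl
  ; hi-top = top-adj }
  where
  a = loᵥ (blocks x) (fromℕ m)
  φ≡skip : ∀ p → φ a (hiᵥ (blocks x) (fromℕ m)) p ≡ skip a p
  φ≡skip p = trans (cong (λ b → φ a b p) top-adj) (φ-adjacent a p)

insertion⇒isPairParent : ∀ {m a} x ρ →
  IsInsertion a (loᵥ (blocks ρ)) (hiᵥ (blocks ρ)) (loᵥ (blocks x)) (hiᵥ (blocks x)) → IsPairParent m x ρ
insertion⇒isPairParent {m} {a} x ρ ins k =
  trans (lo-inject₁ k) (sym (φ≡skip _)) , trans (hi-inject₁ k) (sym (φ≡skip _))
  where
  open IsInsertion ins
  φ≡skip : ∀ p → φ (loᵥ (blocks x) (fromℕ m)) (hiᵥ (blocks x) (fromℕ m)) p ≡ skip a p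
  φ≡skip p = trans (cong₂ (λ a b → φ a b p) lo-top hi-top) (φ-adjacent a p)

insertion-unique : ∀ {m a} {Lρ Hρ : Fin m → ℕ} {Lx Hx Ly Hy : Fin (suc m) → ℕ} →
  IsInsertion a Lρ Hρ Lx Hx → IsInsertion a Lρ Hρ Ly Hy → (∀ k → Lx k ≡ Ly k) × (∀ k → Hx k ≡ Hy k)
insertion-unique {m} {Lx = Lx} {Hx} {Ly} {Hy} x y = lo≗ , hi≗
  where
  module X = IsInsertion x
  module Y = IsInsertion y
  lo≗ : ∀ k → Lx k ≡ Ly k
  lo≗ k with view k
  ... | ‵fromℕ     = trans X.lo-top (sym Y.lo-top)
  ... | ‵inject₁ u = trans (X.lo-inject₁ u) (sym (Y.lo-inject₁ u))
  hi≗ : ∀ k → Hx k ≡ Hy k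
  hi≗ k with view k
  ... | ‵fromℕ     = trans X.hi-top (sym Y.hi-top)
  ... | ‵inject₁ u = trans (X.hi-inject₁ u) (sym (Y.hi-inject₁ u))

insertion-injective : ∀ {m a} {Lρ Hρ Lσ Hσ : Fin m → ℕ} {Lx Hx : Fin (suc m) → ℕ} →
  IsInsertion a Lρ Hρ Lx Hx → IsInsertion a Lσ Hσ Lx Hx → (∀ k → Lρ k ≡ Lσ k) × (∀ k → Hρ k ≡ Hσ k)
insertion-injective {a = a} ρ σ =
    (λ k → skip-injective a (trans (sym (R.lo-inject₁ k)) (S.lo-inject₁ k)))
  , (λ k → skip-injective a (trans (sym (R.hi-inject₁ k)) (S.hi-inject₁ k)))
  where
  module R = IsInsertion ρ
  module S = IsInsertion σ

skipᶠ : ∀ {m} → ℕ → Fin (2 ℕ.* m) → Fin (2 ℕ.* suc m)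
skipᶠ {m} a p = fromℕ< (subst (skip a (toℕ p) <_) (sym (2*suc m)) (skip-bounded a (toℕ<n p)))

skipᶠ-surjective : ∀ {m a} → a ≤ 2 ℕ.* m → (i : Fin (2 ℕ.* suc m)) → toℕ i ≢ a → toℕ i ≢ suc a →
                   Σ (Fin (2 ℕ.* m)) λ p → skip a (toℕ p) ≡ toℕ i
skipᶠ-surjective {m} {a} a≤2m i i≢a i≢1+a =
  let p , p<2m , p↦i = skip-surjective (toℕ i) a≤2m (subst (toℕ i <_) (2*suc m) (toℕ<n i)) i≢a i≢1+a
  in fromℕ< p<2m , trans (cong (skip a) (toℕ-fromℕ< p<2m)) p↦i

gap-lo< : ∀ {m} (c : Fin (suc (2 ℕ.* m))) → toℕ c < 2 ℕ.* suc m
gap-lo< {m} c = subst (toℕ c <_) (sym (2*suc m)) (m<n⇒m<1+n (toℕ<n c))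

gap-hi< : ∀ {m} (c : Fin (suc (2 ℕ.* m))) → suc (toℕ c) < 2 ℕ.* suc m
gap-hi< {m} c = subst (suc (toℕ c) <_) (sym (2*suc m)) (s<s (toℕ<n c))

gapBlock : ∀ {m} → Fin (suc (2 ℕ.* m)) → Block (suc m)
gapBlock c = fromℕ< (gap-lo< c) , fromℕ< (gap-hi< c)

skipBlock : ∀ {m} → ℕ → Block m → Block (suc m)
skipBlock a (p , q) = skipᶠ a p , skipᶠ a q

childBlocks : ∀ {m} → Mon m → Fin (suc (2 ℕ.* m)) → Vec (Block (suc m)) (suc m)
childBlocks ρ c = Vec.map (skipBlock (toℕ c)) (blocks ρ) ∷ʳ gapBlock c

child-insertion : ∀ {m} (ρ : Mon m) c → IsInsertion (toℕ c) (loᵥ (blocks ρ)) (hiᵥ (blocks ρ))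
                                                         (loᵥ (childBlocks ρ c)) (hiᵥ (childBlocks ρ c))
child-insertion ρ c = record
  { lo-inject₁ = λ k → trans (cong (toℕ ∘ proj₁) (shifted k)) (toℕ-fromℕ< _)
  ; hi-inject₁ = λ k → trans (cong (toℕ ∘ proj₂) (shifted k)) (toℕ-fromℕ< _)
  ; lo-top     = trans (cong (toℕ ∘ proj₁) top) (toℕ-fromℕ< (gap-lo< c))
  ; hi-top     = trans (cong (toℕ ∘ proj₂) top) (toℕ-fromℕ< (gap-hi< c)) }
  where
  shifted : ∀ k → lookup (childBlocks ρ c) (inject₁ k) ≡ skipBlock (toℕ c) (lookup (blocks ρ) k)
  shifted k = trans (lookup-∷ʳ-inject₁ (Vec.map (skipBlock (toℕ c)) (blocks ρ)) (gapBlock c) k)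
                    (Vec.lookup-map k (skipBlock (toℕ c)) (blocks ρ))
  top : lookup (childBlocks ρ c) (fromℕ _) ≡ gapBlock c
  top = lookup-∷ʳ-fromℕ (Vec.map (skipBlock (toℕ c)) (blocks ρ)) (gapBlock c)

child : ∀ {m} → Mon m → Fin (suc (2 ℕ.* m)) → Mon (suc m)
child {m} ρ c = mkMon (childBlocks ρ c)
  (valid-resize (sym (2*suc m)) (Insertion.insert-valid (child-insertion ρ c) (s≤s⁻¹ (toℕ<n c)) (Mon-valid ρ)))

module Parent {m} (x : Mon (suc m)) where
  private
    bs = blocks x
    valid = Mon-valid x

  open TopBlock valid (toℕ<n (proj₂ (lookup bs (fromℕ m)))) public using (top-adjacent; endpoint-avoids-gap)

  gapᴺ : ℕ
  gapᴺ = loᵥ bs (fromℕ m)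

  gapᴺ≤2m : gapᴺ ≤ 2 ℕ.* m
  gapᴺ≤2m = s≤s⁻¹ (s≤s⁻¹ (subst₂ _<_ top-adjacent (2*suc m) (toℕ<n (proj₂ (lookup bs (fromℕ m))))))

  gap : Fin (suc (2 ℕ.* m))
  gap = fromℕ< (s≤s gapᴺ≤2m)

  private
    lower : ∀ j (e : Fin (2 ℕ.* suc m)) → loᵥ bs (inject₁ j) ≡ toℕ e ⊎ hiᵥ bs (inject₁ j) ≡ toℕ e →
            Σ (Fin (2 ℕ.* m)) λ p → skip gapᴺ (toℕ p) ≡ toℕ e
    lower j e is-endpoint = uncurry (skipᶠ-surjective gapᴺ≤2m e) (endpoint-avoids-gap j is-endpoint)

    parentBlock : Fin m → Block m
    parentBlock j = proj₁ (lower j (proj₁ (lookup bs (inject₁ j))) (inj₁ refl))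
                  , proj₁ (lower j (proj₂ (lookup bs (inject₁ j))) (inj₂ refl))

  parentBlocks : Vec (Block m) m
  parentBlocks = Vec.tabulate parentBlock

  insertion : IsInsertion gapᴺ (loᵥ parentBlocks) (hiᵥ parentBlocks) (loᵥ bs) (hiᵥ bs)
  insertion = record
    { lo-inject₁ = λ k → sym (trans (cong (skip gapᴺ ∘ toℕ ∘ proj₁) (Vec.lookup∘tabulate parentBlock k))
                                    (proj₂ (lower k _ (inj₁ refl))))
    ; hi-inject₁ = λ k → sym (trans (cong (skip gapᴺ ∘ toℕ ∘ proj₂) (Vec.lookup∘tabulate parentBlock k))
                                    (proj₂ (lower k _ (inj₂ refl))))
    ; lo-top = refl
    ; hi-top = top-adjacent }

  parent : Mon m
  parent = mkMon parentBlocks (Insertion.remove-valid insertion (valid-resize (2*suc m) valid))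

open Parent using (parent; gap)

parent-isPairParent : ∀ {m} (x : Mon (suc m)) → IsPairParent m x (parent x)
parent-isPairParent x = insertion⇒isPairParent x (parent x) (Parent.insertion x)

child-isPairParent : ∀ {m} (ρ : Mon m) c → IsPairParent m (child ρ c) ρ
child-isPairParent ρ c = insertion⇒isPairParent (child ρ c) ρ (child-insertion ρ c)

isPairParent-unique : ∀ {m} {x : Mon (suc m)} {ρ σ} → IsPairParent m x ρ → IsPairParent m x σ → ρ ≡ σ
isPairParent-unique {x = x} {ρ} {σ} x⇝ρ x⇝σ = uncurry (Mon-≡ {x = ρ}) (insertion-injective
  (isPairParent⇒insertion x ρ (Parent.top-adjacent x) x⇝ρ)
  (isPairParent⇒insertion x σ (Parent.top-adjacent x) x⇝σ))

isPairParent⇒≡child : ∀ {m} {x : Mon (suc m)} {ρ} → IsPairParent m x ρ → x ≡ child ρ (gap x)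
isPairParent⇒≡child {x = x} {ρ} x⇝ρ = uncurry (Mon-≡ {x = x}) (insertion-unique
  (isPairParent⇒insertion x ρ (Parent.top-adjacent x) x⇝ρ)
  (subst (λ a → IsInsertion a (loᵥ (blocks ρ)) (hiᵥ (blocks ρ)) (loᵥ cbs) (hiᵥ cbs))
         (toℕ-fromℕ< _) (child-insertion ρ (gap x))))
  where cbs = childBlocks ρ (gap x)

gap-child : ∀ {m} (ρ : Mon m) c → gap (child ρ c) ≡ c
gap-child ρ c = toℕ-injective (trans (toℕ-fromℕ< _) (IsInsertion.lo-top (child-insertion ρ c)))

Mon-inhabited : ∀ m → Mon m
Mon-inhabited zero    = [] , tt
Mon-inhabited (suc m) = child (Mon-inhabited m) zero

child-injective : ∀ {m} {ρ σ : Mon m} {c d} → child ρ c ≡ child σ d → ρ ≡ σ × c ≡ d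
child-injective {m} {ρ} {σ} {c} {d} eq =
    isPairParent-unique {x = child ρ c} {ρ} {σ} (child-isPairParent ρ c)
      (subst (λ x → IsPairParent m x σ) (sym eq) (child-isPairParent σ d))
  , trans (sym (gap-child ρ c)) (trans (cong gap eq) (gap-child σ d))

children : ∀ {m} → Mon m → List (Mon (suc m))
children {m} ρ = List.map (child ρ) (allFin (suc (2 ℕ.* m)))

children-unique : ∀ {m} (ρ : Mon m) → Unique (children ρ)
children-unique ρ = Unique.map⁺ (proj₂ ∘ child-injective) (Unique.allFin⁺ _)

∈-children⁺ : ∀ {m} {x : Mon (suc m)} {ρ} → IsPairParent m x ρ → x ∈ children ρ
∈-children⁺ {x = x} {ρ} x⇝ρ =
  subst (_∈ children ρ) (sym (isPairParent⇒≡child {x = x} {ρ} x⇝ρ)) (∈-map⁺ (child ρ) (∈-allFin (gap x)))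

∈-children⁻ : ∀ {m} {x : Mon (suc m)} {ρ} → x ∈ children ρ → IsPairParent m x ρ
∈-children⁻ {m} {x} {ρ} x∈ =
  let c , _ , x≡ = ∈-map⁻ (child ρ) x∈ in subst (λ x → IsPairParent m x ρ) (sym x≡) (child-isPairParent ρ c)

length-children : ∀ {m} (ρ : Mon m) → length (children ρ) ≡ 2 ℕ.* m ℕ.+ 1
length-children {m} ρ = trans (length-map (child ρ) (allFin (suc (2 ℕ.* m))))
                              (trans (length-tabulate {n = suc (2 ℕ.* m)} id) (ℕ.+-comm 1 (2 ℕ.* m)))

↭-cartesianProductWith-child : ∀ {m} {Ln : List (Mon (suc m))} {Lm : List (Mon m)} →
  Unique Ln → (∀ x → x ∈ Ln) → Unique Lm → (∀ ρ → ρ ∈ Lm) →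
  Ln ↭ cartesianProductWith child Lm (allFin (suc (2 ℕ.* m)))
↭-cartesianProductWith-child Ln! ∈Ln Lm! ∈Lm =
  ↭-unique Ln! (Unique.cartesianProductWith⁺ child child-injective Lm! (Unique.allFin⁺ _))
    λ {x} → mk⇔ (λ _ → subst (_∈ _) (sym (isPairParent⇒≡child {x = x} {parent x} (parent-isPairParent x)))
                                   (∈-cartesianProductWith⁺ child (∈Lm (parent x)) (∈-allFin (gap x))))
                (λ _ → ∈Ln x)

-- The recursion for the expectation

slope : ℤ → ℤ → ℕ → ℚ
slope α β m = ℤ→ℚ (+ (2 ℕ.* m ℕ.+ 1) ℤ.+ (α - β))

intercept : ℤ → ℤ → ℤ → ℕ → ℚ
intercept α β q m = ℤ→ℚ (q ℤ.* α ℤ.+ (+ (2 ℕ.* m ℕ.+ 1) - q) ℤ.* β)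

slope-expand : ∀ α β m → slope α β m ≡ ℕ→ℚ (2 ℕ.* m ℕ.+ 1) + (ℤ→ℚ α ℚ.- ℤ→ℚ β)
slope-expand α β m =
  trans (ℤ→ℚ-+ (+ (2 ℕ.* m ℕ.+ 1)) (α - β)) (cong (_+_ (ℕ→ℚ (2 ℕ.* m ℕ.+ 1))) (ℤ→ℚ-- α β))

intercept-expand : ∀ α β q m →
  intercept α β q m ≡ ℤ→ℚ q * ℤ→ℚ α + (ℕ→ℚ (2 ℕ.* m ℕ.+ 1) ℚ.- ℤ→ℚ q) * ℤ→ℚ β
intercept-expand α β q m = trans (ℤ→ℚ-+ (q ℤ.* α) _) (cong₂ _+_ (ℤ→ℚ-* q α)
  (trans (ℤ→ℚ-* (+ (2 ℕ.* m ℕ.+ 1) - q) β) (cong (_* ℤ→ℚ β) (ℤ→ℚ-- (+ (2 ℕ.* m ℕ.+ 1)) q))))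

enumeration-↭-children : ∀ {m} (Ln : Enumeration (suc m)) (Lm : Enumeration m) →
  proj₁ Ln ↭ cartesianProductWith child (proj₁ Lm) (allFin (suc (2 ℕ.* m)))
enumeration-↭-children (Ln , Ln! , ∈Ln) (Lm , Lm! , ∈Lm) =
  ↭-unique Ln! (Unique.cartesianProductWith⁺ child child-injective Lm! (Unique.allFin⁺ _))
    λ {x} → mk⇔ (λ _ → subst (_∈ _) (sym (isPairParent⇒≡child {x = x} {parent x} (parent-isPairParent x)))
                                   (∈-cartesianProductWith⁺ child (∈Lm (parent x)) (∈-allFin (gap x))))
                (λ _ → ∈Ln x)

length-enumeration : ∀ {m} (Ln : Enumeration (suc m)) (Lm : Enumeration m) →
  length (proj₁ Ln) ≡ length (proj₁ Lm) ℕ.* (2 ℕ.* m ℕ.+ 1)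
length-enumeration {m} Ln Lm = trans (↭.↭-length (enumeration-↭-children Ln Lm))
  (trans (length-cartesianProductWith child (proj₁ Lm) _)
         (cong (length (proj₁ Lm) ℕ.*_) (trans (length-tabulate {n = suc (2 ℕ.* m)} id) (ℕ.+-comm 1 (2 ℕ.* m)))))

module _ {α β q : ℤ} {Z : (n : ℕ) → Mon n → ℚ} (rec : PairRecursive2 α β q Z) {m : ℕ} (1≤m : 1 ≤ m) where

  sumℚ-children : ∀ ρ → sumℚ (Z (suc m)) (children ρ) ≡ slope α β m * Z m ρ + intercept α β q m
  sumℚ-children ρ =
    let Co , Co! , Co⇝ρ , on-Co , off-Co , |Co| = rec m 1≤m ρ in begin
    sumℚ (Z (suc m)) (children ρ)
      ≡⟨ sumℚ-two-valued Mon-≟ (Z (suc m)) Co! (children-unique ρ) (∈-children⁺ ∘ Co⇝ρ _)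
           (λ {y} y∈Co → on-Co y (Co⇝ρ y y∈Co) y∈Co)
           (λ {y} y∈ y∉Co → off-Co y (∈-children⁻ y∈) y∉Co) ⟩
    ℕ→ℚ (length Co) * (z + a) + (ℕ→ℚ (length (children ρ)) ℚ.- ℕ→ℚ (length Co)) * (z + b)
      ≡⟨ cong₂ (λ c n → c * (z + a) + (n ℚ.- c) * (z + b)) |Co| (cong ℕ→ℚ (length-children ρ)) ⟩
    (z + q′) * (z + a) + (s ℚ.- (z + q′)) * (z + b)
      ≡⟨ solve 5 (λ z q a b s → (z :+ q) :* (z :+ a) :+ (s :- (z :+ q)) :* (z :+ b)
                              := (s :+ (a :- b)) :* z :+ (q :* a :+ (s :- q) :* b)) refl z q′ a b s ⟩
    (s + (a ℚ.- b)) * z + (q′ * a + (s ℚ.- q′) * b)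
      ≡⟨ cong₂ (λ A B → A * z + B) (slope-expand α β m) (intercept-expand α β q m) ⟨
    slope α β m * z + intercept α β q m ∎
    where
    open ≡-Reasoning
    open +-*-Solver
    z = Z m ρ
    a = ℤ→ℚ α
    b = ℤ→ℚ β
    q′ = ℤ→ℚ q
    s = ℕ→ℚ (2 ℕ.* m ℕ.+ 1)

  sumℚ-enumeration : (Ln : Enumeration (suc m)) (Lm : Enumeration m) →
    sumℚ (Z (suc m)) (proj₁ Ln)
      ≡ slope α β m * sumℚ (Z m) (proj₁ Lm) + ℕ→ℚ (length (proj₁ Lm)) * intercept α β q m
  sumℚ-enumeration Ln Lm = begin
    sumℚ (Z (suc m)) (proj₁ Ln)
      ≡⟨ sumℚ-↭ (Z (suc m)) (enumeration-↭-children Ln Lm) ⟩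
    sumℚ (Z (suc m)) (cartesianProductWith child (proj₁ Lm) (allFin (suc (2 ℕ.* m))))
      ≡⟨ sumℚ-cartesianProductWith (Z (suc m)) child (proj₁ Lm) _ ⟩
    sumℚ (λ ρ → sumℚ (Z (suc m)) (children ρ)) (proj₁ Lm)
      ≡⟨ sumℚ-cong (proj₁ Lm) (λ {ρ} _ → sumℚ-children ρ) ⟩
    sumℚ (λ ρ → slope α β m * Z m ρ + intercept α β q m) (proj₁ Lm)
      ≡⟨ sumℚ-affine (slope α β m) (intercept α β q m) (Z m) (proj₁ Lm) ⟩
    slope α β m * sumℚ (Z m) (proj₁ Lm) + ℕ→ℚ (length (proj₁ Lm)) * intercept α β q m ∎
    where open ≡-Reasoning

corollary7p8 : (α β q : ℤ) (Z : (n : ℕ) → Mon n → ℚ) → PairRecursive2 α β q Z →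
    (m : ℕ) → 1 ≤ m → (Ln : Enumeration (suc m)) (Lm : Enumeration m) →
    E Z Ln ≡ (ℤ→ℚ ((+ (2 Data.Nat.* m Data.Nat.+ 1)) Data.Integer.+ (α - β)) * inv (2 Data.Nat.* m Data.Nat.+ 1)) * E Z Lm
             + ℤ→ℚ ((q Data.Integer.* α) Data.Integer.+ ((+ (2 Data.Nat.* m Data.Nat.+ 1) - q) Data.Integer.* β)) * inv (2 Data.Nat.* m Data.Nat.+ 1)
corollary7p8 α β q Z rec m 1≤m Ln@(Lₙ , _) Lm@(Lₘ , _ , ∈Lₘ) = begin
  sumℚ (Z (suc m)) Lₙ * inv (length Lₙ)
    ≡⟨ cong₂ _*_ (sumℚ-enumeration {α} {β} {q} {Z} rec 1≤m Ln Lm) (cong inv (length-enumeration Ln Lm)) ⟩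
  (slope α β m * sumℚ (Z m) Lₘ + ℕ→ℚ (length Lₘ) * intercept α β q m) * inv (length Lₘ ℕ.* s)
    ≡⟨ affine-mean (length Lₘ) s (slope α β m) (sumℚ (Z m) Lₘ) (intercept α β q m) ⟩
  (slope α β m * inv s) * E Z Lm + intercept α β q m * inv s ∎
  where
  open ≡-Reasoning
  s = 2 ℕ.* m ℕ.+ 1
  instance
    |Lₘ|≢0 : NonZero (length Lₘ)
    |Lₘ|≢0 = ∈⇒length-nonZero (∈Lₘ (Mon-inhabited m))
    s≢0 : NonZero s
    s≢0 = ℕ.>-nonZero (ℕ.m≤n+m 1 (2 ℕ.* m))
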